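{- Let $G$ and $H$ be connected graphs and $\mathcal{G}=G\times H$. Let $S$ be a minimum 3-restricted edge-cut of $\mathcal{G}$, and let $D_1$ and $D_2$ be the two components of $\mathcal{G}-S$. If there exist two non-adjacent edges $u_1u_2$ and $u_3u_4$ of $G$ such that $H^{u_1}\cup H^{u_2}\subseteq V(D_1)$ and $H^{u_3}\cup H^{u_4}\subseteq V(D_2)$, then $|S|\geq 2e(H)\lambda_2(G)$.
   Context: The direct product $G\times H$ has vertex set $V(G)\times V(H)$, with $(u_1,v_1)$ adjacent to $(u_2,v_2)$ iff $u_1u_2\in E(G)$ and $v_1v_2\in E(H)$. For $u\in V(G)$, $H^u=\{(u,v):v\in V(H)\}$ is the $H$-layer of $u$. $e(H)$ is the number of edges of $H$. A 3-restricted edge-cut of a graph $X$ is an edge set $S$ such that $X-S$ is disconnected and every component has at least 3 vertices. $\lambda_2(G)$ is the minimum size of an edge set whose removal disconnects $G$ so that every component has at least 2 vertices ($+\infty$ if no such set exists). -}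

module Defs where

open import Data.Nat using (ℕ; zero; suc; _+_; _*_; _<ᵇ_)
open import Data.Bool using (Bool; true; false; _∧_; not; if_then_else_)
open import Data.Fin using (Fin; toℕ; combine; quotient; remainder)
open import Data.List using (List; map; allFin)
open import Data.Nat.ListAction using (sum)
open import Data.Product using (Σ; ∃; _×_; _,_)
open import Data.Sum using (_⊎_)
open import Relation.Nullary using (¬_)
open import Relation.Binary.PropositionalEquality using (_≡_)
open import Function.Definitions using (Injective)

record Graph : Set where
  field
    n      : ℕ
    adj    : Fin n → Fin n → Bool
    sym    : ∀ i j → adj i j ≡ adj j i
    irrefl : ∀ i → adj i i ≡ false
open Graph public

countPairs : {n : ℕ} → (Fin n → Fin n → Bool) → ℕ
countPairs {n} R =
  sum (map (λ i → sum (map (λ j → if (toℕ i <ᵇ toℕ j) ∧ R i j then 1 else 0)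
                           (allFin n)))
           (allFin n))

e : Graph → ℕ
e X = countPairs (adj X)

record EdgeSet (X : Graph) : Set where
  field
    mem    : Fin (n X) → Fin (n X) → Bool
    memSym : ∀ i j → mem i j ≡ mem j i
    sub    : ∀ i j → mem i j ≡ true → adj X i j ≡ true
open EdgeSet public

size : {X : Graph} → EdgeSet X → ℕ
size S = countPairs (mem S)

data Reach {n : ℕ} (A : Fin n → Fin n → Bool) : Fin n → Fin n → Set where
  here : ∀ {i} → Reach A i i
  step : ∀ {i j k} → A i j ≡ true → Reach A j k → Reach A i k

Connected : Graph → Set
Connected X = ∀ i j → Reach (adj X) i j

minus : (X : Graph) → EdgeSet X → Fin (n X) → Fin (n X) → Bool
minus X S i j = adj X i j ∧ not (mem S i j)

AtLeast : {n : ℕ} → ℕ → (Fin n → Set) → Set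
AtLeast {n} k P = Σ (Fin k → Fin n) λ f → Injective _≡_ _≡_ f × (∀ i → P (f i))

-- S is a k-restricted edge-cut of X: X - S is disconnected and every
-- component (the set of vertices reachable from some v) has >= k vertices.
RestrictedCut : ℕ → (X : Graph) → EdgeSet X → Set
RestrictedCut k X S =
  (∃ λ u → ∃ λ v → ¬ Reach (minus X S) u v)
  × (∀ v → AtLeast k (λ w → Reach (minus X S) v w))

MinRestrictedCut : ℕ → (X : Graph) → EdgeSet X → Set
MinRestrictedCut k X S =
  RestrictedCut k X S × (∀ (T : EdgeSet X) → RestrictedCut k X T → size S Data.Nat.≤ size T)
  where import Data.Nat

-- Direct product G × H on vertex set Fin (n G * n H); the vertex (u , v)
-- is  combine u v.
product : Graph → Graph → Graph
product G H = record
  { n = n G * n H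
  ; adj = λ x y → adj G (quotient (n H) x) (quotient (n H) y)
                  ∧ adj H (remainder {n G} (n H) x) (remainder {n G} (n H) y)
  ; sym = symP
  ; irrefl = irrP
  }
  where
  open import Relation.Binary.PropositionalEquality using (cong₂; refl)
  open import Data.Bool.Properties using (∧-zeroˡ)
  symP : ∀ x y → _ ≡ _
  symP x y = cong₂ _∧_ (sym G _ _) (sym H _ _)
  irrP : ∀ x → (adj G (quotient (n H) x) (quotient (n H) x)
                 ∧ adj H (remainder {n G} (n H) x) (remainder {n G} (n H) x)) ≡ false
  irrP x rewrite irrefl G (quotient (n H) x) = refl

{-# OPTIONS --safe #-}
module Submission where

-- For v ∈ V(H) let X_v = {u : (u , v) ∈ D₁}. If vv' is an edge of H, every ordered pair (u , u') of
-- adjacent vertices of G with u ∈ X_v ⇎ u' ∈ X_v' gives an edge (u , v)(u' , v') from D₁ to D₂,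
-- which lies in S; so the number of such pairs is at most the number of arcs of S from H^v to H^v'.
-- An exchange inequality bounds |∂(X_v ∩ X_v')| + |∂(X_v ∪ X_v')| by twice that number, and both
-- sets contain u₁, u₂ but not u₃, u₄. Passing to suitable components turns the boundary of the
-- cheaper one into a 2-restricted edge-cut of G that is no larger. The cheapest of these cuts,
-- over the 2 e(H) arcs vv' of H, is at most their average, and summed over all arcs of H the
-- bounds count every arc of S exactly once: 2 e(H) · 2 |T| ≤ 2 |S|.

open import Defs renaming (sym to adj-sym)
open import Data.Bool using (Bool; true; false; _∧_; _∨_; not; _xor_; if_then_else_)
import Data.Bool as B
open import Data.Bool.Properties
  using (∨-zeroʳ; ∧-idem; ∨-idem; ∧-comm; ¬-not; not-involutive; xor-comm; xor-same)
open import Data.Fin using (Fin; zero; suc; toℕ; combine; quotient; remainder; _↑ˡ_; _↑ʳ_)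
import Data.Fin as F
open import Data.Fin.Properties using (toℕ-injective; any?; remQuot-combine)
open import Data.List using (map; allFin; tabulate)
open import Data.List.Properties using (map-tabulate)
open import Data.Nat using (ℕ; zero; suc; _+_; _*_; _≤_; _<_; _<ᵇ_; _≤ᵇ_; z≤n; s≤s)
open import Data.Nat.GeneralisedArithmetic using (fold)
open import Data.Nat.Induction using (<-wellFounded)
import Data.Nat.ListAction as List
open import Data.Nat.Properties
open import Algebra.Properties.CommutativeSemigroup *-commutativeSemigroup using (x∙yz≈y∙xz)
open import Algebra.Properties.Semiring.Sum +-*-semiring
  using (sum; sum-syntax; sum-cong-≗; ∑-comm; ∑-distrib-+; *-distribʳ-sum)
open import Data.Product using (∃; _×_; _,_; proj₁; proj₂)
open import Data.Sum using (_⊎_; inj₁; inj₂; [_,_]′)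
open import Function using (_∘_)
open import Induction.WellFounded using (Acc; acc)
open import Relation.Nullary using (¬_; yes; no; does; contradiction; ofʸ; ofⁿ; _×-dec_)
open import Relation.Nullary.Decidable using (dec-true)
open import Relation.Binary.PropositionalEquality

𝟙 : Bool → ℕ
𝟙 b = if b then 1 else 0

𝟙-mono : ∀ {a b} → (a ≡ true → b ≡ true) → 𝟙 a ≤ 𝟙 b
𝟙-mono {false} _ = z≤n
𝟙-mono {true} a⇒b rewrite a⇒b refl = ≤-refl

∑-mono-≤ : ∀ {k} {f g : Fin k → ℕ} → (∀ i → f i ≤ g i) → sum f ≤ sum g
∑-mono-≤ {zero} _ = z≤n
∑-mono-≤ {suc k} f≤g = +-mono-≤ (f≤g zero) (∑-mono-≤ (f≤g ∘ suc))

∑∑-distrib-+ : ∀ {a b} (f g : Fin a → Fin b → ℕ) →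
  ∑[ i < a ] ∑[ j < b ] (f i j + g i j)
    ≡ ∑[ i < a ] ∑[ j < b ] f i j + ∑[ i < a ] ∑[ j < b ] g i j
∑∑-distrib-+ {a} {b} f g =
  trans (sum-cong-≗ λ i → ∑-distrib-+ (f i) (g i)) (∑-distrib-+ (λ i → ∑[ j < b ] f i j) _)

∑-↑ : ∀ a b (f : Fin (a + b) → ℕ) → sum f ≡ ∑[ i < a ] f (i ↑ˡ b) + ∑[ j < b ] f (a ↑ʳ j)
∑-↑ zero b f = refl
∑-↑ (suc a) b f = trans (cong (f zero +_) (∑-↑ a b (f ∘ suc))) (sym (+-assoc (f zero) _ _))

∑-combine : ∀ a b (f : Fin (a * b) → ℕ) → sum f ≡ ∑[ i < a ] ∑[ j < b ] f (combine i j)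
∑-combine zero b f = refl
∑-combine (suc a) b f =
  trans (∑-↑ b (a * b) f) (cong (sum (λ j → f (j ↑ˡ a * b)) +_) (∑-combine a b (f ∘ (b ↑ʳ_))))

sum-map-allFin : ∀ k (f : Fin k → ℕ) → List.sum (map f (allFin k)) ≡ sum f
sum-map-allFin k f = trans (cong List.sum (map-tabulate {n = k} (λ i → i) f)) (sum-tabulate k)
  where
  sum-tabulate : ∀ k {g : Fin k → ℕ} → List.sum (tabulate g) ≡ sum g
  sum-tabulate zero = refl
  sum-tabulate (suc k) {g} = cong (g zero +_) (sum-tabulate k)

∧-true : ∀ {a b} → a ∧ b ≡ true → a ≡ true × b ≡ true
∧-true {true} b = refl , b

not-true : ∀ {b} → not b ≡ true → b ≡ false
not-true {false} _ = refl

⇒false : ∀ {a b} → (a ≡ true → b ≡ true) → b ≡ false → a ≡ false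
⇒false {false} _   _      = refl
⇒false {true}  a⇒b b≡false = trans (sym (a⇒b refl)) b≡false

count : ∀ {k} → (Fin k → Bool) → ℕ
count {k} P = ∑[ i < k ] 𝟙 (P i)

count≤ : ∀ {k} (P : Fin k → Bool) → count P ≤ k
count≤ {zero} P = z≤n
count≤ {suc k} P with P zero
... | true  = s≤s (count≤ (P ∘ suc))
... | false = m≤n⇒m≤1+n (count≤ (P ∘ suc))

count-< : ∀ {k} {P Q : Fin k → Bool} → (∀ i → P i ≡ true → Q i ≡ true) →
  ∀ j → P j ≡ false → Q j ≡ true → count P < count Q
count-< P⊆Q zero Pj Qj rewrite Pj | Qj = s≤s (∑-mono-≤ λ i → 𝟙-mono (P⊆Q (suc i)))
count-< P⊆Q (suc j) Pj Qj = +-mono-≤-< (𝟙-mono (P⊆Q zero)) (count-< (P⊆Q ∘ suc) j Pj Qj)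

arcs : ∀ {k} → (Fin k → Fin k → Bool) → ℕ
arcs {k} R = ∑[ i < k ] ∑[ j < k ] 𝟙 (R i j)

arcs-mono : ∀ {k} {R R' : Fin k → Fin k → Bool} →
  (∀ i j → R i j ≡ true → R' i j ≡ true) → arcs R ≤ arcs R'
arcs-mono R⊆R' = ∑-mono-≤ λ i → ∑-mono-≤ λ j → 𝟙-mono (R⊆R' i j)

module _ {k} (R : Fin k → Fin k → Bool) where
  private
    forward backward : Fin k → Fin k → ℕ
    forward i j = 𝟙 ((toℕ i <ᵇ toℕ j) ∧ R i j)
    backward i j = 𝟙 ((toℕ j <ᵇ toℕ i) ∧ R i j)

    split-by-order : (∀ i → R i i ≡ false) → ∀ i j → 𝟙 (R i j) ≡ forward i j + backward i j
    split-by-order irr i j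
      with toℕ i <ᵇ toℕ j | <ᵇ-reflects-< (toℕ i) (toℕ j)
         | toℕ j <ᵇ toℕ i | <ᵇ-reflects-< (toℕ j) (toℕ i)
    ... | true  | ofʸ i<j | true  | ofʸ j<i = contradiction j<i (<-asym i<j)
    ... | true  | _       | false | _       = sym (+-identityʳ _)
    ... | false | _       | true  | _       = refl
    ... | false | ofⁿ i≮j | false | ofⁿ j≮i
      rewrite toℕ-injective (≤-antisym (≮⇒≥ j≮i) (≮⇒≥ i≮j)) | irr j = refl

  arcs≡2*countPairs : (∀ i j → R i j ≡ R j i) → (∀ i → R i i ≡ false) → arcs R ≡ 2 * countPairs R
  arcs≡2*countPairs R-sym irr = begin
    arcs R
      ≡⟨ sum-cong-≗ (λ i → sum-cong-≗ (split-by-order irr i)) ⟩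
    ∑[ i < k ] ∑[ j < k ] (forward i j + backward i j)
      ≡⟨ ∑∑-distrib-+ forward backward ⟩
    ∑∑ forward + ∑∑ backward
      ≡⟨ cong (∑∑ forward +_) backward≡forward ⟩
    ∑∑ forward + ∑∑ forward
      ≡⟨ cong (λ m → m + m) (sym countPairs≡) ⟩
    countPairs R + countPairs R
      ≡⟨ cong (countPairs R +_) (sym (+-identityʳ _)) ⟩
    2 * countPairs R ∎
    where
    open ≡-Reasoning
    ∑∑ : (Fin k → Fin k → ℕ) → ℕ
    ∑∑ f = ∑[ i < k ] ∑[ j < k ] f i j
    countPairs≡ : countPairs R ≡ ∑∑ forward
    countPairs≡ = trans (sum-map-allFin k (λ i → List.sum (map (forward i) (allFin k))))
                        (sum-cong-≗ λ i → sum-map-allFin k (forward i))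
    backward≡forward : ∑∑ backward ≡ ∑∑ forward
    backward≡forward = trans (∑-comm backward)
      (sum-cong-≗ λ j → sum-cong-≗ λ i → cong (λ b → 𝟙 ((toℕ j <ᵇ toℕ i) ∧ b)) (R-sym i j))

module _ {k} {A : Fin k → Fin k → Bool} where

  Reach-trans : ∀ {i j l} → Reach A i j → Reach A j l → Reach A i l
  Reach-trans here q = q
  Reach-trans (step a p) q = step a (Reach-trans p q)

  Reach-snoc : ∀ {i j l} → Reach A i j → A j l ≡ true → Reach A i l
  Reach-snoc p a = Reach-trans p (step a here)

  Reach-sym : (∀ i j → A i j ≡ A j i) → ∀ {i j} → Reach A i j → Reach A j i
  Reach-sym A-sym here = here
  Reach-sym A-sym (step {i} {j} a p) = Reach-snoc (Reach-sym A-sym p) (trans (A-sym j i) a)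

  Reach-invariant : (I : Fin k → Set) → (∀ {a b} → I a → A a b ≡ true → I b) →
    ∀ {i j} → I i → Reach A i j → I j
  Reach-invariant I step-I Ii here = Ii
  Reach-invariant I step-I Ii (step a p) = Reach-invariant I step-I (step-I Ii a) p

  Reach-map : {B : Fin k → Fin k → Bool} (I : Fin k → Set) →
    (∀ {a b} → I a → A a b ≡ true → I b × B a b ≡ true) →
    ∀ {i j} → I i → Reach A i j → Reach B i j
  Reach-map I step-I Ii here = here
  Reach-map I step-I Ii (step a p) = step (proj₂ (step-I Ii a)) (Reach-map I step-I (proj₁ (step-I Ii a)) p)

  Reach-leaves : ∀ {i j} → Reach A i j → i ≢ j → ∃ λ l → A i l ≡ true
  Reach-leaves here i≢i = contradiction refl i≢i
  Reach-leaves (step {j = l} a _) _ = l , a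

module Reachability {k} (A : Fin k → Fin k → Bool) where

  Closed : (Fin k → Bool) → Set
  Closed R = ∀ {x y} → R x ≡ true → A x y ≡ true → R y ≡ true

  private
    arcInto : (Fin k → Bool) → Fin k → Bool
    arcInto R y = does (any? λ x → R x ∧ A x y B.≟ true)

    grow : (Fin k → Bool) → Fin k → Bool
    grow R y = R y ∨ arcInto R y

    grow-⊇ : ∀ {R} y → R y ≡ true → grow R y ≡ true
    grow-⊇ {R} y Ry = cong (_∨ arcInto R y) Ry

    grow-step : ∀ {R x y} → R x ≡ true → A x y ≡ true → grow R y ≡ true
    grow-step {R} {x} {y} Rx Axy =
      trans (cong (R y ∨_) (dec-true (any? _) (x , cong₂ _∧_ Rx Axy))) (∨-zeroʳ (R y))

    grow-elim : ∀ {R y} → grow R y ≡ true → R y ≡ true ⊎ ∃ λ x → R x ≡ true × A x y ≡ true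
    grow-elim {R} {y} h with R y | any? (λ x → R x ∧ A x y B.≟ true)
    ... | true  | _ = inj₁ refl
    ... | false | yes (x , RxAxy) = inj₂ (x , ∧-true RxAxy)

    grow-closed : ∀ {R} → Closed R → Closed (grow R)
    grow-closed {R} closed Rx Axy = grow-⊇ _ (closed (shrink (grow-elim Rx)) Axy)
      where
      shrink : ∀ {x} → R x ≡ true ⊎ (∃ λ z → R z ≡ true × A z x ≡ true) → R x ≡ true
      shrink (inj₁ Rx) = Rx
      shrink (inj₂ (z , Rz , Azx)) = closed Rz Azx

    closed-or-grows : ∀ R → Closed R ⊎ count R < count (grow R)
    closed-or-grows R with any? (λ y → not (R y) ∧ grow R y B.≟ true)
    ... | yes (y , new) =
      inj₂ (count-< grow-⊇ y (not-true (proj₁ (∧-true new))) (proj₂ (∧-true new)))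
    ... | no nothing-new = inj₁ closed
      where
      closed : Closed R
      closed {x} {y} Rx Axy with R y in Ry
      ... | true  = refl
      ... | false = contradiction (y , cong₂ _∧_ (cong not Ry) (grow-step Rx Axy)) nothing-new

    grows : (Fin k → Bool) → ℕ → Fin k → Bool
    grows R m = fold R grow m

    closed-or-large : ∀ R m → Closed (grows R m) ⊎ m ≤ count (grows R m)
    closed-or-large R zero = inj₂ z≤n
    closed-or-large R (suc m) with closed-or-large R m
    ... | inj₁ closed = inj₁ (grow-closed closed)
    ... | inj₂ m≤count with closed-or-grows (grows R m)
    ...   | inj₁ closed = inj₁ (grow-closed closed)
    ...   | inj₂ count< = inj₂ (≤-trans (s≤s m≤count) count<)

  -- After k + 1 rounds the set is closed, since every round that is not closed adds a vertex.
  -- Opaque, so that later conversion checks never unfold the iteration.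
  opaque
    reachable : Fin k → Fin k → Bool
    reachable r = grows (λ y → does (r F.≟ y)) (suc k)

    reachable-closed : ∀ r → Closed (reachable r)
    reachable-closed r with closed-or-large (λ y → does (r F.≟ y)) (suc k)
    ... | inj₁ closed = closed
    ... | inj₂ large = contradiction (count≤ (reachable r)) (<⇒≱ large)

    reachable-root : ∀ r → reachable r r ≡ true
    reachable-root r = grows-⊇ (suc k) (dec-true (r F.≟ r) refl)
      where
      grows-⊇ : ∀ {R} m → R r ≡ true → grows R m r ≡ true
      grows-⊇ zero Rr = Rr
      grows-⊇ (suc m) Rr = grow-⊇ r (grows-⊇ m Rr)

    reachable-sound : ∀ {r y} → reachable r y ≡ true → Reach A r y
    reachable-sound {r} = grows-sound (suc k)
      where
      grows-sound : ∀ m {y} → grows (λ y → does (r F.≟ y)) m y ≡ true → Reach A r y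
      grows-sound zero {y} h with r F.≟ y
      ... | yes refl = here
      grows-sound (suc m) h with grow-elim h
      ... | inj₁ old = grows-sound m old
      ... | inj₂ (x , Rx , Axy) = Reach-snoc (grows-sound m Rx) Axy

  reachable-complete : ∀ {r y} → Reach A r y → reachable r y ≡ true
  reachable-complete {r} =
    Reach-invariant (λ y → reachable r y ≡ true) (reachable-closed r) (reachable-root r)

VertexSet : Graph → Set
VertexSet G = Fin (n G) → Bool

induced : (G : Graph) → VertexSet G → Fin (n G) → Fin (n G) → Bool
induced G X u u' = adj G u u' ∧ (X u ∧ X u')

boundary : (G : Graph) → VertexSet G → Fin (n G) → Fin (n G) → Bool
boundary G X u u' = adj G u u' ∧ (X u xor X u')

induced⇒inside : ∀ G X {u u'} → induced G X u u' ≡ true → X u' ≡ true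
induced⇒inside G X {u} {u'} h = proj₂ (∧-true {X u} (proj₂ (∧-true {adj G u u'} h)))

induced-sym : ∀ G X u u' → induced G X u u' ≡ induced G X u' u
induced-sym G X u u' = cong₂ _∧_ (adj-sym G u u') (∧-comm (X u) (X u'))

boundary-sym : ∀ G X u u' → boundary G X u u' ≡ boundary G X u' u
boundary-sym G X u u' = cong₂ _∧_ (adj-sym G u u') (xor-comm (X u) (X u'))

boundary-not : ∀ G X u u' → boundary G (not ∘ X) u u' ≡ boundary G X u u'
boundary-not G X u u' = cong (adj G u u' ∧_) (not-xor-not (X u) (X u'))
  where
  not-xor-not : ∀ a b → not a xor not b ≡ a xor b
  not-xor-not true  b = refl
  not-xor-not false b = not-involutive b

boundaryEdges : (G : Graph) → VertexSet G → EdgeSet G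
boundaryEdges G X = record
  { mem    = boundary G X
  ; memSym = boundary-sym G X
  ; sub    = λ u u' → proj₁ ∘ ∧-true
  }

module _ (G : Graph) (X : VertexSet G) {u u' : Fin (n G)} where

  minus-boundary⇒same-side : minus G (boundaryEdges G X) u u' ≡ true → X u ≡ X u'
  minus-boundary⇒same-side h with adj G u u' | X u | X u'
  ... | true | true  | true  = refl
  ... | true | false | false = refl

  same-side⇒minus-boundary : adj G u u' ≡ true → X u ≡ X u' → minus G (boundaryEdges G X) u u' ≡ true
  same-side⇒minus-boundary uu' same rewrite uu' | same | xor-same (X u') = refl

module Component (G : Graph) (X : VertexSet G) {r : Fin (n G)} (Xr : X r ≡ true) where
  open Reachability (induced G X)

  component : VertexSet G
  component = reachable r

  component-root : component r ≡ true
  component-root = reachable-root r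

  component-⊆ : ∀ {u} → component u ≡ true → X u ≡ true
  component-⊆ h = Reach-invariant (λ a → X a ≡ true) (λ _ → induced⇒inside G X) Xr (reachable-sound h)

  component-step : ∀ {u u'} → component u ≡ true → adj G u u' ≡ true → X u' ≡ true →
    component u' ≡ true
  component-step {u} {u'} cu uu' Xu' =
    reachable-closed r {u} {u'} cu (cong₂ _∧_ uu' (cong₂ _∧_ (component-⊆ cu) Xu'))

  leaves-component⇒leaves : ∀ {a b} → component a ≡ true → component b ≡ false → adj G a b ≡ true →
    boundary G X a b ≡ true
  leaves-component⇒leaves {a} {b} ca cb ab = cong₂ _∧_ ab (cong₂ _xor_ (component-⊆ ca) Xb≡false)
    where
    Xb≡false : X b ≡ false
    Xb≡false = ¬-not λ Xb → contradiction (trans (sym (component-step ca ab Xb)) cb) λ ()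

  boundary-component⊆boundary : ∀ u u' → boundary G component u u' ≡ true → boundary G X u u' ≡ true
  boundary-component⊆boundary u u' h with component u in cu | component u' in cu'
  ... | true  | false = leaves-component⇒leaves cu cu' (proj₁ (∧-true h))
  ... | false | true  =
    trans (boundary-sym G X u u')
          (leaves-component⇒leaves cu' cu (trans (adj-sym G u' u) (proj₁ (∧-true h))))
  ... | true  | true  = contradiction (proj₂ (∧-true {adj G u u'} h)) λ ()
  ... | false | false = contradiction (proj₂ (∧-true {adj G u u'} h)) λ ()

  component-walk : (Z : VertexSet G) → (∀ {a} → component a ≡ true → Z a ≡ Z r) →
    ∀ {w} → component w ≡ true → Reach (minus G (boundaryEdges G Z)) w r
  component-walk Z Z-const cw =
    Reach-map (λ a → component a ≡ true) stays cw (Reach-sym (induced-sym G X) (reachable-sound cw))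
    where
    stays : ∀ {a b} → component a ≡ true → induced G X a b ≡ true →
      component b ≡ true × minus G (boundaryEdges G Z) a b ≡ true
    stays {a} {b} ca ab = cb , same-side⇒minus-boundary G Z ab' (trans (Z-const ca) (sym (Z-const cb)))
      where
      ab' : adj G a b ≡ true
      ab' = proj₁ (∧-true {adj G a b} ab)
      cb : component b ≡ true
      cb = component-step ca ab' (induced⇒inside G X ab)

adjacent⇒distinct : ∀ X {u u'} → adj X u u' ≡ true → u ≢ u'
adjacent⇒distinct X {u} uu' refl = contradiction (trans (sym uu') (irrefl X u)) λ ()

AtLeast-2 : ∀ {k} {P : Fin k → Set} {a b} → a ≢ b → P a → P b → AtLeast 2 P
AtLeast-2 {k} {P} {a} {b} a≢b Pa Pb = pick , pick-injective , λ { zero → Pa ; (suc zero) → Pb }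
  where
  pick : Fin 2 → Fin k
  pick zero       = a
  pick (suc zero) = b
  pick-injective : ∀ {i j} → pick i ≡ pick j → i ≡ j
  pick-injective {zero}     {zero}     _ = refl
  pick-injective {zero}     {suc zero} p = contradiction p a≢b
  pick-injective {suc zero} {zero}     p = contradiction (sym p) a≢b
  pick-injective {suc zero} {suc zero} _ = refl

restrictedCut₂ : (X : Graph) (T : EdgeSet X) {a a' b b' : Fin (n X)} →
  minus X T a a' ≡ true → minus X T b b' ≡ true → ¬ Reach (minus X T) a b →
  (∀ w → Reach (minus X T) w a ⊎ Reach (minus X T) w b) → RestrictedCut 2 X T
restrictedCut₂ X T {a} {b = b} aa' bb' a↛b reaches =
  (a , b , a↛b) , λ w → [ two aa' , two bb' ]′ (reaches w)
  where
  two : ∀ {w c c'} → minus X T c c' ≡ true → Reach (minus X T) w c → AtLeast 2 (Reach (minus X T) w)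
  two {c = c} cc' wc =
    AtLeast-2 (adjacent⇒distinct X (proj₁ (∧-true {adj X c _} cc'))) wc (Reach-snoc wc cc')

-- C is the component of u₁ in G[X] and D the component of u₃ in G − C. Passing to a component
-- never enlarges the boundary, and every vertex outside D reaches C by a walk avoiding D, so the
-- two sides of ∂D are connected.
module _ (G : Graph) (connected : Connected G) {u₁ u₂ u₃ u₄ : Fin (n G)}
         (u₁u₂ : adj G u₁ u₂ ≡ true) (u₃u₄ : adj G u₃ u₄ ≡ true)
         (X : VertexSet G) (Xu₁ : X u₁ ≡ true) (Xu₂ : X u₂ ≡ true)
         (Xu₃ : X u₃ ≡ false) (Xu₄ : X u₄ ≡ false)
         where
  private
    module C = Component G X Xu₁
    C : VertexSet G
    C = C.component

    Cu₃ : C u₃ ≡ false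
    Cu₃ = ⇒false C.component-⊆ Xu₃

    module D = Component G (not ∘ C) (cong not Cu₃)
    D : VertexSet G
    D = D.component
    cut : EdgeSet G
    cut = boundaryEdges G D

    D-false-on-C : ∀ {a} → C a ≡ true → D a ≡ false
    D-false-on-C Ca = ⇒false D.component-⊆ (cong not Ca)

    Du₁ : D u₁ ≡ false
    Du₁ = D-false-on-C C.component-root

    Du₂ : D u₂ ≡ false
    Du₂ = D-false-on-C (C.component-step C.component-root u₁u₂ Xu₂)

    Du₄ : D u₄ ≡ true
    Du₄ = D.component-step D.component-root u₃u₄ (cong not (⇒false C.component-⊆ Xu₄))

    u₁↛u₃ : ¬ Reach (minus G cut) u₁ u₃
    u₁↛u₃ p = contradiction (trans (sym D.component-root) (Reach-invariant (λ a → D a ≡ false)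
                (λ Da e → trans (sym (minus-boundary⇒same-side G D e)) Da) Du₁ p)) λ ()

    reaches-u₁ : ∀ {x} → D x ≡ false → Reach (adj G) x u₁ → Reach (minus G cut) x u₁
    reaches-u₁ {x} Dx walk with C x B.≟ true
    ... | yes Cx = C.component-walk D (λ Ca → trans (D-false-on-C Ca) (sym Du₁)) Cx
    ... | no ¬Cx with walk
    ...   | here = here
    ...   | step {j = y} xy walk′ =
      step (same-side⇒minus-boundary G D xy (trans Dx (sym Dy))) (reaches-u₁ Dy walk′)
      where
      Dy : D y ≡ false
      Dy = ⇒false (λ Dy → D.component-step Dy (trans (adj-sym G y x) xy) (cong not (¬-not ¬Cx))) Dx

    reaches : ∀ w → Reach (minus G cut) w u₁ ⊎ Reach (minus G cut) w u₃
    reaches w with D w in Dw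
    ... | true  = inj₂ (D.component-walk D (λ Da → trans Da (sym D.component-root)) Dw)
    ... | false = inj₁ (reaches-u₁ Dw (connected w u₁))

  restrictedCut₂≤boundary :
    ∃ λ (T : EdgeSet G) → RestrictedCut 2 G T × arcs (mem T) ≤ arcs (boundary G X)
  restrictedCut₂≤boundary = cut , restrictedCut₂ G cut
    (same-side⇒minus-boundary G D u₁u₂ (trans Du₁ (sym Du₂)))
    (same-side⇒minus-boundary G D u₃u₄ (trans D.component-root (sym Du₄)))
    u₁↛u₃ reaches
    , arcs-mono λ u u' h → C.boundary-component⊆boundary u u'
        (trans (sym (boundary-not G C u u')) (D.boundary-component⊆boundary u u' h))

cross : (G : Graph) → VertexSet G → VertexSet G → ℕ
cross G X Y = arcs λ u u' → adj G u u' ∧ (X u xor Y u')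

private
  ∧∨-exchange : ∀ a b a' b' →
    B.T (𝟙 ((a ∧ b) xor (a' ∧ b')) + 𝟙 ((a ∨ b) xor (a' ∨ b')) ≤ᵇ 𝟙 (a xor b') + 𝟙 (a' xor b))
  ∧∨-exchange true  true  true  true  = _
  ∧∨-exchange true  true  true  false = _
  ∧∨-exchange true  true  false true  = _
  ∧∨-exchange true  true  false false = _
  ∧∨-exchange true  false true  true  = _
  ∧∨-exchange true  false true  false = _
  ∧∨-exchange true  false false true  = _
  ∧∨-exchange true  false false false = _
  ∧∨-exchange false true  true  true  = _
  ∧∨-exchange false true  true  false = _
  ∧∨-exchange false true  false true  = _
  ∧∨-exchange false true  false false = _
  ∧∨-exchange false false true  true  = _
  ∧∨-exchange false false true  false = _
  ∧∨-exchange false false false true  = _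
  ∧∨-exchange false false false false = _

  boundary-∧∨-exchange : ∀ e a b a' b' →
    𝟙 (e ∧ ((a ∧ b) xor (a' ∧ b'))) + 𝟙 (e ∧ ((a ∨ b) xor (a' ∨ b')))
      ≤ 𝟙 (e ∧ (a xor b')) + 𝟙 (e ∧ (a' xor b))
  boundary-∧∨-exchange false a b a' b' = z≤n
  boundary-∧∨-exchange true  a b a' b' = ≤ᵇ⇒≤ _ _ (∧∨-exchange a b a' b')

m+m≤n+n⇒m≤n : ∀ {m n} → m + m ≤ n + n → m ≤ n
m+m≤n+n⇒m≤n m+m≤n+n = ≮⇒≥ λ n<m → <⇒≱ (+-mono-< n<m n<m) m+m≤n+n

module _ (G : Graph) (X Y : VertexSet G) where
  private
    k : ℕ
    k = n G
    X∧Y X∨Y : VertexSet G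
    X∧Y u = X u ∧ Y u
    X∨Y u = X u ∨ Y u

  boundary-∧+boundary-∨≤ : arcs (boundary G X∧Y) + arcs (boundary G X∨Y) ≤ cross G X Y + cross G X Y
  boundary-∧+boundary-∨≤ = begin
    arcs (boundary G X∧Y) + arcs (boundary G X∨Y)
      ≡⟨ ∑∑-distrib-+ (λ u u' → 𝟙 (boundary G X∧Y u u')) _ ⟨
    ∑[ u < k ] ∑[ u' < k ] (𝟙 (boundary G X∧Y u u') + 𝟙 (boundary G X∨Y u u'))
      ≤⟨ ∑-mono-≤ (λ u → ∑-mono-≤ λ u' →
           boundary-∧∨-exchange (adj G u u') (X u) (Y u) (X u') (Y u')) ⟩
    ∑[ u < k ] ∑[ u' < k ] (𝟙 (adj G u u' ∧ (X u xor Y u')) + 𝟙 (adj G u u' ∧ (X u' xor Y u)))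
      ≡⟨ ∑∑-distrib-+ (λ u u' → 𝟙 (adj G u u' ∧ (X u xor Y u'))) _ ⟩
    cross G X Y + ∑[ u < k ] ∑[ u' < k ] 𝟙 (adj G u u' ∧ (X u' xor Y u))
      ≡⟨ cong (cross G X Y +_) (trans (∑-comm (λ u u' → 𝟙 (adj G u u' ∧ (X u' xor Y u))))
           (sum-cong-≗ λ u' → sum-cong-≗ λ u →
           cong (λ e → 𝟙 (e ∧ (X u' xor Y u))) (adj-sym G u u'))) ⟩
    cross G X Y + cross G X Y ∎
    where open ≤-Reasoning

  cheaper-of-∧-∨ : ∃ λ (Z : VertexSet G) →
    (∀ u → X u ≡ Y u → Z u ≡ X u) × arcs (boundary G Z) ≤ cross G X Y
  cheaper-of-∧-∨ with arcs (boundary G X∧Y) ≤? arcs (boundary G X∨Y)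
  ... | yes ∧≤∨ = X∧Y , (λ u X≡Y → trans (cong (X u ∧_) (sym X≡Y)) (∧-idem (X u)))
                      , m+m≤n+n⇒m≤n (≤-trans (+-monoʳ-≤ _ ∧≤∨) boundary-∧+boundary-∨≤)
  ... | no ∧≰∨ = X∨Y , (λ u X≡Y → trans (cong (X u ∨_) (sym X≡Y)) (∨-idem (X u)))
                     , m+m≤n+n⇒m≤n (≤-trans (+-monoˡ-≤ _ (<⇒≤ (≰⇒> ∧≰∨))) boundary-∧+boundary-∨≤)

arcs*≤∑∑ : ∀ {k} (R : Fin k → Fin k → Bool) (g : Fin k → Fin k → ℕ) {c : ℕ} →
  (∀ i j → R i j ≡ true → c ≤ g i j) → arcs R * c ≤ ∑[ i < k ] ∑[ j < k ] g i j
arcs*≤∑∑ {k} R g {c} c≤g = begin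
  arcs R * c
    ≡⟨ *-distribʳ-sum c (λ i → ∑[ j < k ] 𝟙 (R i j)) ⟩
  ∑[ i < k ] ((∑[ j < k ] 𝟙 (R i j)) * c)
    ≡⟨ sum-cong-≗ (λ i → *-distribʳ-sum c (λ j → 𝟙 (R i j))) ⟩
  ∑[ i < k ] ∑[ j < k ] (𝟙 (R i j) * c)
    ≤⟨ ∑-mono-≤ (λ i → ∑-mono-≤ (bound i)) ⟩
  ∑[ i < k ] ∑[ j < k ] g i j ∎
  where
  open ≤-Reasoning
  bound : ∀ i j → 𝟙 (R i j) * c ≤ g i j
  bound i j with R i j in Rij
  ... | true  = ≤-trans (≤-reflexive (+-identityʳ c)) (c≤g i j Rij)
  ... | false = z≤n

module _ {a b} (P : Fin a → Fin b → Bool) (c : Fin a → Fin b → ℕ) where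

  minimiser : ∀ {i j} → P i j ≡ true →
    ∃ λ i → ∃ λ j → P i j ≡ true × ∀ k l → P k l ≡ true → c i j ≤ c k l
  minimiser {i} {j} Pij = descend Pij (<-wellFounded (c i j))
    where
    descend : ∀ {i j} → P i j ≡ true → Acc _<_ (c i j) →
      ∃ λ i → ∃ λ j → P i j ≡ true × ∀ k l → P k l ≡ true → c i j ≤ c k l
    descend {i} {j} Pij (acc smaller)
      with any? (λ k → any? λ l → (P k l B.≟ true) ×-dec (c k l <? c i j))
    ... | yes (k , l , Pkl , ckl<cij) = descend Pkl (smaller ckl<cij)
    ... | no none = i , j , Pij , λ k l Pkl → ≮⇒≥ λ ckl<cij → none (k , l , Pkl , ckl<cij)

averaging : ∀ {k} (R : Fin k → Fin k → Bool) (c g : Fin k → Fin k → ℕ) {i j} → R i j ≡ true →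
  (∀ i j → R i j ≡ true → c i j ≤ g i j) →
  ∃ λ i → ∃ λ j → arcs R * c i j ≤ ∑[ i < k ] ∑[ j < k ] g i j
averaging R c g Rij c≤g with minimiser R c Rij
... | i , j , _ , cheapest =
  i , j , arcs*≤∑∑ R g λ k l Rkl → ≤-trans (cheapest k l Rkl) (c≤g k l Rkl)

arcs-adj : (X : Graph) → arcs (adj X) ≡ 2 * e X
arcs-adj X = arcs≡2*countPairs (adj X) (adj-sym X) (irrefl X)

arcs-edges : {X : Graph} (S : EdgeSet X) → arcs (mem S) ≡ 2 * size S
arcs-edges {X} S = arcs≡2*countPairs (mem S) (memSym S) λ i → ⇒false (sub S i i) (irrefl X i)

restrictedCut⇒edge : ∀ {k} (X : Graph) (S : EdgeSet X) → RestrictedCut (2 + k) X S →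
  ∃ λ x → ∃ λ y → adj X x y ≡ true
restrictedCut⇒edge X S ((x , _) , large) with large x
... | f , f-injective , reach = x , proj₁ leaves , proj₁ (∧-true {adj X x _} (proj₂ leaves))
  where
  leaves : ∃ λ y → minus X S x y ≡ true
  leaves with x F.≟ f zero
  ... | no x≢f₀  = Reach-leaves (reach zero) x≢f₀
  ... | yes x≡f₀ = Reach-leaves (reach (suc zero)) λ x≡f₁ →
                     contradiction (f-injective (trans (sym x≡f₀) x≡f₁)) λ ()

module _ (G H : Graph) where

  product-adj : ∀ u v u' v' → adj (product G H) (combine u v) (combine u' v') ≡ adj G u u' ∧ adj H v v'
  product-adj u v u' v' =
    cong₂ _∧_ (cong₂ (adj G) (cong proj₁ (remQuot-combine u v)) (cong proj₁ (remQuot-combine u' v')))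
              (cong₂ (adj H) (cong proj₂ (remQuot-combine u v)) (cong proj₂ (remQuot-combine u' v')))

  product-adj⇒adjʳ : ∀ {x y} → adj (product G H) x y ≡ true →
    adj H (remainder {n G} (n H) x) (remainder {n G} (n H) y) ≡ true
  product-adj⇒adjʳ {x} {y} = proj₂ ∘ ∧-true {adj G (quotient (n H) x) (quotient (n H) y)}

  module _ (S : EdgeSet (product G H)) where

    layerArcs : Fin (n H) → Fin (n H) → ℕ
    layerArcs v v' = arcs {n G} λ u u' → mem S (combine u v) (combine u' v')

    arcs≡∑layerArcs : arcs (mem S) ≡ ∑[ v < n H ] ∑[ v' < n H ] layerArcs v v'
    arcs≡∑layerArcs = begin
      arcs (mem S)
        ≡⟨ ∑-combine (n G) (n H) (λ x → ∑[ y < n G * n H ] 𝟙 (mem S x y)) ⟩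
      ∑[ u < n G ] ∑[ v < n H ] ∑[ y < n G * n H ] 𝟙 (mem S (combine u v) y)
        ≡⟨ sum-cong-≗ (λ u → sum-cong-≗ (split-target u)) ⟩
      ∑[ u < n G ] ∑[ v < n H ] ∑[ u' < n G ] ∑[ v' < n H ] s u v u' v'
        ≡⟨ sum-cong-≗ (λ u → sum-cong-≗ λ v → ∑-comm (s u v)) ⟩
      ∑[ u < n G ] ∑[ v < n H ] ∑[ v' < n H ] ∑[ u' < n G ] s u v u' v'
        ≡⟨ ∑-comm (λ u v → ∑[ v' < n H ] ∑[ u' < n G ] s u v u' v') ⟩
      ∑[ v < n H ] ∑[ u < n G ] ∑[ v' < n H ] ∑[ u' < n G ] s u v u' v'
        ≡⟨ sum-cong-≗ (λ v → ∑-comm (λ u v' → ∑[ u' < n G ] s u v u' v')) ⟩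
      ∑[ v < n H ] ∑[ v' < n H ] layerArcs v v' ∎
      where
      open ≡-Reasoning
      s : Fin (n G) → Fin (n H) → Fin (n G) → Fin (n H) → ℕ
      s u v u' v' = 𝟙 (mem S (combine u v) (combine u' v'))
      split-target : ∀ u v →
        ∑[ y < n G * n H ] 𝟙 (mem S (combine u v) y) ≡ ∑[ u' < n G ] ∑[ v' < n H ] s u v u' v'
      split-target u v = ∑-combine (n G) (n H) _

module Sides (G H : Graph) (S : EdgeSet (product G H)) {x₁ x₂ : Fin (n G * n H)}
  (x₁↛x₂ : ¬ Reach (minus (product G H) S) x₁ x₂)
  (cover : ∀ w → Reach (minus (product G H) S) x₁ w ⊎ Reach (minus (product G H) S) x₂ w)
  where
  private
    M : Fin (n G * n H) → Fin (n G * n H) → Bool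
    M = minus (product G H) S

    M-sym : ∀ w w' → M w w' ≡ M w' w
    M-sym w w' = cong₂ _∧_ (adj-sym (product G H) w w') (cong not (memSym S w w'))

  side : Fin (n G * n H) → Bool
  side w = [ (λ _ → true) , (λ _ → false) ]′ (cover w)

  side-x₁ : ∀ {w} → Reach M x₁ w → side w ≡ true
  side-x₁ {w} x₁w with cover w
  ... | inj₁ _   = refl
  ... | inj₂ x₂w = contradiction (Reach-trans x₁w (Reach-sym M-sym x₂w)) x₁↛x₂

  side-x₂ : ∀ {w} → Reach M x₂ w → side w ≡ false
  side-x₂ {w} x₂w with cover w
  ... | inj₁ x₁w = contradiction (Reach-trans x₁w (Reach-sym M-sym x₂w)) x₁↛x₂
  ... | inj₂ _   = refl

  side-edge : ∀ {w w'} → M w w' ≡ true → side w ≡ side w'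
  side-edge {w} ww' =
    [ (λ x₁w → trans (side-x₁ x₁w) (sym (side-x₁ (Reach-snoc x₁w ww'))))
    , (λ x₂w → trans (side-x₂ x₂w) (sym (side-x₂ (Reach-snoc x₂w ww')))) ]′ (cover w)

  layer : Fin (n H) → VertexSet G
  layer v u = side (combine u v)

  crossing⇒∈S : ∀ {u u' v v'} → adj H v v' ≡ true → adj G u u' ∧ (layer v u xor layer v' u') ≡ true →
    mem S (combine u v) (combine u' v') ≡ true
  crossing⇒∈S {u} {u'} {v} {v'} vv' h = ¬-not λ ∉S →
    contradiction (trans (sym (proj₂ (∧-true h))) (trans (cong (_xor layer v' u') (side-edge (kept ∉S)))
                                                        (xor-same (layer v' u'))))
                  λ ()
    where
    kept : mem S (combine u v) (combine u' v') ≡ false → M (combine u v) (combine u' v') ≡ true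
    kept ∉S = cong₂ _∧_ (trans (product-adj G H u v u' v') (cong₂ _∧_ (proj₁ (∧-true h)) vv'))
                        (cong not ∉S)

  cross≤layerArcs : ∀ {v v'} → adj H v v' ≡ true → cross G (layer v) (layer v') ≤ layerArcs G H S v v'
  cross≤layerArcs {v} {v'} vv' = arcs-mono λ u u' → crossing⇒∈S {u} {u'} {v} {v'} vv'

module LayerCuts (G H : Graph) (connected : Connected G) (S : EdgeSet (product G H))
  {x₁ x₂ : Fin (n G * n H)}
  (x₁↛x₂ : ¬ Reach (minus (product G H) S) x₁ x₂)
  (cover : ∀ w → Reach (minus (product G H) S) x₁ w ⊎ Reach (minus (product G H) S) x₂ w)
  {u₁ u₂ u₃ u₄ : Fin (n G)} (u₁u₂ : adj G u₁ u₂ ≡ true) (u₃u₄ : adj G u₃ u₄ ≡ true)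
  (in-D₁ : ∀ v → Reach (minus (product G H) S) x₁ (combine u₁ v)
               × Reach (minus (product G H) S) x₁ (combine u₂ v))
  (in-D₂ : ∀ v → Reach (minus (product G H) S) x₂ (combine u₃ v)
               × Reach (minus (product G H) S) x₂ (combine u₄ v))
  where
  open Sides G H S x₁↛x₂ cover

  layerCut : ∀ v v' → ∃ λ (T : EdgeSet G) →
    RestrictedCut 2 G T × (adj H v v' ≡ true → arcs (mem T) ≤ layerArcs G H S v v')
  layerCut v v' = T , T-cut , λ vv' → ≤-trans T≤∂Z (≤-trans ∂Z≤cross (cross≤layerArcs vv'))
    where
    cheaper : ∃ λ (Z : VertexSet G) →
      (∀ u → layer v u ≡ layer v' u → Z u ≡ layer v u) ×
      arcs (boundary G Z) ≤ cross G (layer v) (layer v')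
    cheaper = cheaper-of-∧-∨ G (layer v) (layer v')
    Z : VertexSet G
    Z = proj₁ cheaper
    ∂Z≤cross : arcs (boundary G Z) ≤ cross G (layer v) (layer v')
    ∂Z≤cross = proj₂ (proj₂ cheaper)
    Z-fixed : ∀ {u b} → (∀ w → layer w u ≡ b) → Z u ≡ b
    Z-fixed {u} always-b =
      trans (proj₁ (proj₂ cheaper) u (trans (always-b v) (sym (always-b v')))) (always-b v)
    cut : ∃ λ (T : EdgeSet G) → RestrictedCut 2 G T × arcs (mem T) ≤ arcs (boundary G Z)
    cut = restrictedCut₂≤boundary G connected u₁u₂ u₃u₄ Z
            (Z-fixed (side-x₁ ∘ proj₁ ∘ in-D₁)) (Z-fixed (side-x₁ ∘ proj₂ ∘ in-D₁))
            (Z-fixed (side-x₂ ∘ proj₁ ∘ in-D₂)) (Z-fixed (side-x₂ ∘ proj₂ ∘ in-D₂))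
    T : EdgeSet G
    T = proj₁ cut
    T-cut : RestrictedCut 2 G T
    T-cut = proj₁ (proj₂ cut)
    T≤∂Z : arcs (mem T) ≤ arcs (boundary G Z)
    T≤∂Z = proj₂ (proj₂ cut)

  cheapestLayerCut : ∀ {v₀ v₀'} → adj H v₀ v₀' ≡ true →
    ∃ λ (T : EdgeSet G) → RestrictedCut 2 G T × arcs (adj H) * arcs (mem T) ≤ arcs (mem S)
  cheapestLayerCut v₀v₀' = T , proj₁ (proj₂ (layerCut v v')) ,
    subst (arcs (adj H) * arcs (mem T) ≤_) (sym (arcs≡∑layerArcs G H S)) averaged
    where
    cost : Fin (n H) → Fin (n H) → ℕ
    cost v v' = arcs (mem (proj₁ (layerCut v v')))
    cheapest : ∃ λ v → ∃ λ v' →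
      arcs (adj H) * cost v v' ≤ ∑[ w < n H ] ∑[ w' < n H ] layerArcs G H S w w'
    cheapest =
      averaging (adj H) cost (layerArcs G H S) v₀v₀' (λ w w' → proj₂ (proj₂ (layerCut w w')))
    v v' : Fin (n H)
    v  = proj₁ cheapest
    v' = proj₁ (proj₂ cheapest)
    T : EdgeSet G
    T = proj₁ (layerCut v v')
    averaged : arcs (adj H) * arcs (mem T) ≤ ∑[ w < n H ] ∑[ w' < n H ] layerArcs G H S w w'
    averaged = proj₂ (proj₂ cheapest)

arcs-bound⇒size-bound : ∀ {G X} (H : Graph) (T : EdgeSet G) (S : EdgeSet X) →
  arcs (adj H) * arcs (mem T) ≤ arcs (mem S) → 2 * e H * size T ≤ size S
arcs-bound⇒size-bound H T S arcs-bound = *-cancelˡ-≤ 2 (begin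
  2 * (2 * e H * size T)       ≡⟨ x∙yz≈y∙xz (2 * e H) 2 (size T) ⟨
  2 * e H * (2 * size T)       ≡⟨ cong₂ _*_ (arcs-adj H) (arcs-edges T) ⟨
  arcs (adj H) * arcs (mem T)  ≤⟨ arcs-bound ⟩
  arcs (mem S)                 ≡⟨ arcs-edges S ⟩
  2 * size S                   ∎)
  where open ≤-Reasoning

lemma2p3 : (G H : Graph) → Connected G → Connected H →
    (S : EdgeSet (product G H)) → MinRestrictedCut 3 (product G H) S →
    -- x₁, x₂ represent the two components D₁, D₂ of G×H − S
    (x₁ x₂ : Fin (n G * n H)) →
    ¬ Reach (minus (product G H) S) x₁ x₂ →
    (∀ w → Reach (minus (product G H) S) x₁ w ⊎ Reach (minus (product G H) S) x₂ w) →
    (u₁ u₂ u₃ u₄ : Fin (n G)) →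
    adj G u₁ u₂ ≡ true → adj G u₃ u₄ ≡ true →
    u₁ ≢ u₃ → u₁ ≢ u₄ → u₂ ≢ u₃ → u₂ ≢ u₄ →
    (∀ v → Reach (minus (product G H) S) x₁ (combine u₁ v)
         × Reach (minus (product G H) S) x₁ (combine u₂ v)) →
    (∀ v → Reach (minus (product G H) S) x₂ (combine u₃ v)
         × Reach (minus (product G H) S) x₂ (combine u₄ v)) →
    -- |S| ≥ 2 e(H) λ₂(G), with λ₂(G) = min size of a 2-restricted edge-cut (+∞ if none)
    ∃ λ (T : EdgeSet G) → RestrictedCut 2 G T × 2 * e H * size T ≤ size S
lemma2p3 G H connected _ S (S-cut , _) x₁ x₂ x₁↛x₂ cover _ _ _ _ u₁u₂ u₃u₄ _ _ _ _ in-D₁ in-D₂ =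
  let _ , _ , product-edge = restrictedCut⇒edge (product G H) S S-cut
      T , T-cut , T-cheap = LayerCuts.cheapestLayerCut G H connected S x₁↛x₂ cover
                              u₁u₂ u₃u₄ in-D₁ in-D₂ (product-adj⇒adjʳ G H product-edge)
  in T , T-cut , arcs-bound⇒size-bound H T S T-cheap
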